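{- Let $k\geq 2$ be an integer, let $G$ be a graph with minimum degree $\delta(G)\geq k+1$, and let $\mathcal{S}=(P,x)$ be an optimal $k$-path-vertex schema of $G$. Then every vertex $y\in V(G)\setminus V(\mathcal{S})$ has at most $k+2$ neighbors in $V(\mathcal{S})$. Moreover, if some vertex $y\in V(G)\setminus V(\mathcal{S})$ has exactly $k+2$ neighbors in $V(\mathcal{S})$, then $x$ is adjacent to $y$, every vertex of $P$ is adjacent to $x$, and $|V(\mathcal{S})|=k+2$.
   Context: All graphs are finite and simple. For an integer $k\geq 2$ and a graph $G$, a $k$-path-vertex schema of $G$ is a pair $\mathcal{S}=(P,x)$ where $P$ is a path in $G$ and $x$ is a vertex not on $P$ having exactly $k+1$ neighbors in $V(P)$; we write $V(\mathcal{S})=V(P)\cup\{x\}$, and the cardinality of $\mathcal{S}$ is $|V(\mathcal{S})|$. A $k$-path-vertex schema is optimal if its cardinality is minimum among all $k$-path-vertex schemas of $G$. -}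

module Defs where

open import Data.Nat using (ℕ; suc; _+_; _≤_)
open import Data.Bool using (Bool; true; false)
open import Data.Fin using (Fin)
open import Data.List using (List; []; _∷_; length; filter)
open import Data.List.Membership.Propositional using (_∈_; _∉_)
open import Data.List.Relation.Unary.Unique.Propositional using (Unique)
open import Data.List.Relation.Unary.All using (All)
open import Data.Product using (_×_; Σ; _,_)
open import Data.Unit using (⊤)
open import Relation.Binary.PropositionalEquality using (_≡_)
open import Relation.Nullary.Decidable using (Dec; yes; no)
open import Data.Vec.Functional using (Vector)
open import Data.List using () renaming (tabulate to ltab)

record Graph (n : ℕ) : Set where
  field
    adj   : Fin n → Fin n → Bool
    sym   : ∀ u v → adj u v ≡ adj v u
    irrfl : ∀ u → adj u u ≡ false
open Graph public

Adj : ∀ {n} → Graph n → Fin n → Fin n → Set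
Adj G u v = adj G u v ≡ true

allVertices : ∀ n → List (Fin n)
allVertices n = ltab (λ i → i)

nbrsIn : ∀ {n} → Graph n → Fin n → List (Fin n) → ℕ
nbrsIn G v [] = 0
nbrsIn G v (u ∷ us) with adj G v u
... | true  = suc (nbrsIn G v us)
... | false = nbrsIn G v us

degree : ∀ {n} → Graph n → Fin n → ℕ
degree {n} G v = nbrsIn G v (allVertices n)

MinDegAtLeast : ∀ {n} → Graph n → ℕ → Set
MinDegAtLeast G d = ∀ v → d ≤ degree G v

Walk : ∀ {n} → Graph n → List (Fin n) → Set
Walk G [] = ⊤
Walk G (u ∷ []) = ⊤
Walk G (u ∷ v ∷ us) = Adj G u v × Walk G (v ∷ us)

IsPath : ∀ {n} → Graph n → List (Fin n) → Set
IsPath G p = (1 ≤ length p) × Unique p × Walk G p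

record Schema {n} (G : Graph n) (k : ℕ) : Set where
  constructor schema
  field
    P      : List (Fin n)
    x      : Fin n
    isPath : IsPath G P
    x∉P    : x ∉ P
    nbrs   : nbrsIn G x P ≡ suc k
open Schema public

VS : ∀ {n} {G : Graph n} {k} → Schema G k → List (Fin n)
VS S = x S ∷ P S

-- cardinality |V(S)| (the entries are pairwise distinct)
card : ∀ {n} {G : Graph n} {k} → Schema G k → ℕ
card S = length (VS S)

Optimal : ∀ {n} {G : Graph n} {k} → Schema G k → Set
Optimal {G = G} {k} S = ∀ (T : Schema G k) → card S ≤ card T

-- Let P be the path of an optimal schema, so every path on which some outside vertex has exactly
-- k + 1 neighbours has at least |P| vertices. An outside vertex y therefore has at most k + 1
-- neighbours on P (else cut P just after its (k+1)-st neighbour), and if it has exactly k + 1, it is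
-- adjacent to both ends of P (else drop that end). If in addition y ~ x and x missed some vertex of
-- P, then, as x is adjacent to the first vertex, P = A u w B with x ~ u and x ≁ w; the path B y A
-- is one vertex shorter than P and x still has k + 1 neighbours on it. So x is adjacent to all of
-- P, which forces |P| = k + 1.
module Submission where

open import Defs hiding (sym)
open import Data.Nat using (ℕ; zero; suc; _+_; _≤_; z≤n; s≤s; s≤s⁻¹)
open import Data.Nat.Properties
  using ( suc-injective; +-suc; +-comm; +-identityʳ; ≤-trans; ≤-refl; m≤n+m; n≤1+n
        ; m+1+n≰m; m+n≮n; 1+n≰n; ≰⇒>; module ≤-Reasoning)
open import Data.Bool using (Bool; true; false)
open import Data.Fin using (Fin)
open import Data.List using (List; []; _∷_; _++_; [_]; length; initLast; _∷ʳ′_)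
open import Data.List.Properties using (length-++; ++-assoc)
open import Data.List.Relation.Unary.Any using (here; there)
open import Data.List.Relation.Unary.All as All using (All; []; _∷_)
open import Data.List.Relation.Unary.All.Properties using (¬Any⇒All¬) renaming (++⁻ˡ to All-++⁻ˡ)
open import Data.List.Relation.Unary.AllPairs using ([]; _∷_)
open import Data.List.Relation.Unary.Unique.Propositional using (Unique)
open import Data.List.Membership.Propositional using (_∉_)
open import Data.List.Membership.Propositional.Properties using (∈-++⁺ˡ; ∈-++⁺ʳ)
import Data.List.Relation.Binary.Permutation.Setoid as Permutation
import Data.List.Relation.Binary.Permutation.Setoid.Properties as PermutationProperties
open import Data.Product using (_×_; _,_; proj₁; ∃₂)
open import Data.Sum using (_⊎_; inj₁; inj₂)
open import Data.Unit using (tt)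
open import Data.Empty using (⊥; ⊥-elim)
open import Function using (_∘_)
open import Relation.Nullary using (¬_; contradiction)
open import Relation.Binary.PropositionalEquality
  using (_≡_; refl; sym; trans; cong; subst; setoid; module ≡-Reasoning)

module _ {A : Set} where

  ++-length-≤ˡ⇒[] : ∀ (xs ys : List A) → length (xs ++ ys) ≤ length xs → ys ≡ []
  ++-length-≤ˡ⇒[] xs []       _  = refl
  ++-length-≤ˡ⇒[] xs (_ ∷ ys) le = contradiction (subst (_≤ length xs) (length-++ xs) le) (m+1+n≰m _)

  ++-length-≤ʳ⇒[] : ∀ (xs ys : List A) → length (xs ++ ys) ≤ length ys → xs ≡ []
  ++-length-≤ʳ⇒[] []       ys _  = refl
  ++-length-≤ʳ⇒[] (_ ∷ xs) ys le =
    contradiction (subst (λ m → suc m ≤ length ys) (length-++ xs) le) (m+n≮n _ _)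

  Unique-++⁻ˡ : ∀ (xs ys : List A) → Unique (xs ++ ys) → Unique xs
  Unique-++⁻ˡ []       ys _            = []
  Unique-++⁻ˡ (x ∷ xs) ys (x∉ ∷ uniq) = All-++⁻ˡ xs x∉ ∷ Unique-++⁻ˡ xs ys uniq

  Unique-++⁻ʳ : ∀ (xs ys : List A) → Unique (xs ++ ys) → Unique ys
  Unique-++⁻ʳ []       ys uniq       = uniq
  Unique-++⁻ʳ (x ∷ xs) ys (_ ∷ uniq) = Unique-++⁻ʳ xs ys uniq

  record Descent (f : A → Bool) (xs : List A) : Set where
    field
      before after : List A
      high low     : A
      split        : xs ≡ before ++ high ∷ low ∷ after
      high-true    : f high ≡ true
      low-false    : f low ≡ false

  Descent-∷ : ∀ {f xs} u → Descent f xs → Descent f (u ∷ xs)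
  Descent-∷ u d = record
    { before = u ∷ before ; after = after ; high = high ; low = low
    ; split = cong (u ∷_) split ; high-true = high-true ; low-false = low-false }
    where open Descent d

  all-or-descent : ∀ (f : A → Bool) u xs → f u ≡ true →
                   All (λ v → f v ≡ true) (u ∷ xs) ⊎ Descent f (u ∷ xs)
  all-or-descent f u []       fu = inj₁ (fu ∷ [])
  all-or-descent f u (w ∷ xs) fu with f w in fw
  ... | false = inj₂ (record { before = [] ; after = xs ; split = refl ; high-true = fu ; low-false = fw })
  ... | true with all-or-descent f w xs fw
  ...   | inj₁ all = inj₁ (fu ∷ all)
  ...   | inj₂ d   = inj₂ (Descent-∷ u d)

module _ {n : ℕ} (G : Graph n) where

  Adj-sym : ∀ {u v} → Adj G u v → Adj G v u
  Adj-sym {u} {v} uv = trans (Graph.sym G v u) uv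

  nbrsIn-∷-adj : ∀ {v u} us → Adj G v u → nbrsIn G v (u ∷ us) ≡ suc (nbrsIn G v us)
  nbrsIn-∷-adj us vu rewrite vu = refl

  nbrsIn-∷-nonadj : ∀ {v u} us → adj G v u ≡ false → nbrsIn G v (u ∷ us) ≡ nbrsIn G v us
  nbrsIn-∷-nonadj us vu rewrite vu = refl

  nbrsIn-∷-≤ : ∀ v u us → nbrsIn G v (u ∷ us) ≤ suc (nbrsIn G v us)
  nbrsIn-∷-≤ v u us with adj G v u
  ... | true  = ≤-refl
  ... | false = n≤1+n _

  nbrsIn-∷-saturated : ∀ {v u m} us → nbrsIn G v (u ∷ us) ≡ suc (suc m) → nbrsIn G v us ≤ suc m →
                       Adj G v u × nbrsIn G v us ≡ suc m
  nbrsIn-∷-saturated {v} {u} us count bound with adj G v u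
  ... | true  = refl , suc-injective count
  ... | false = contradiction (subst (_≤ _) count bound) 1+n≰n

  nbrsIn-≤-length : ∀ v us → nbrsIn G v us ≤ length us
  nbrsIn-≤-length v []       = z≤n
  nbrsIn-≤-length v (u ∷ us) = ≤-trans (nbrsIn-∷-≤ v u us) (s≤s (nbrsIn-≤-length v us))

  nbrsIn-suc⇒nonempty : ∀ {v m} us → nbrsIn G v us ≡ suc m → 1 ≤ length us
  nbrsIn-suc⇒nonempty {v} us count = ≤-trans (s≤s z≤n) (subst (_≤ length us) count (nbrsIn-≤-length v us))

  nbrsIn-++ : ∀ v xs ys → nbrsIn G v (xs ++ ys) ≡ nbrsIn G v xs + nbrsIn G v ys
  nbrsIn-++ v []       ys = refl
  nbrsIn-++ v (u ∷ xs) ys with adj G v u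
  ... | true  = cong suc (nbrsIn-++ v xs ys)
  ... | false = nbrsIn-++ v xs ys

  nbrsIn-all : ∀ {v} us → All (Adj G v) us → nbrsIn G v us ≡ length us
  nbrsIn-all []       []          = refl
  nbrsIn-all (u ∷ us) (vu ∷ all) = trans (nbrsIn-∷-adj us vu) (cong suc (nbrsIn-all us all))

  split-at-nbrs : ∀ v us m → m ≤ nbrsIn G v us →
                  ∃₂ λ xs ys → us ≡ xs ++ ys × nbrsIn G v xs ≡ m
  split-at-nbrs v us       zero    _  = [] , us , refl , refl
  split-at-nbrs v (u ∷ us) (suc m) le with adj G v u in vu
  ... | true  = let xs , ys , us≡ , count = split-at-nbrs v us m (s≤s⁻¹ le)
                in u ∷ xs , ys , cong (u ∷_) us≡ , trans (nbrsIn-∷-adj xs vu) (cong suc count)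
  ... | false = let xs , ys , us≡ , count = split-at-nbrs v us (suc m) le
                in u ∷ xs , ys , cong (u ∷_) us≡ , trans (nbrsIn-∷-nonadj xs vu) count

  Walk-++⁻ˡ : ∀ xs ys → Walk G (xs ++ ys) → Walk G xs
  Walk-++⁻ˡ []           ys _          = tt
  Walk-++⁻ˡ (u ∷ [])     ys _          = tt
  Walk-++⁻ˡ (u ∷ v ∷ xs) ys (uv , walk) = uv , Walk-++⁻ˡ (v ∷ xs) ys walk

  Walk-∷⁻ : ∀ u us → Walk G (u ∷ us) → Walk G us
  Walk-∷⁻ u []      _          = tt
  Walk-∷⁻ u (_ ∷ _) (_ , walk) = walk

  Walk-++⁻ʳ : ∀ xs ys → Walk G (xs ++ ys) → Walk G ys
  Walk-++⁻ʳ []       ys walk = walk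
  Walk-++⁻ʳ (u ∷ xs) ys walk = Walk-++⁻ʳ xs ys (Walk-∷⁻ u (xs ++ ys) walk)

  Walk-join : ∀ xs v ys → Walk G (xs ++ [ v ]) → Walk G (v ∷ ys) → Walk G (xs ++ v ∷ ys)
  Walk-join []           v ys _           walk = walk
  Walk-join (u ∷ [])     v ys (uv , _)    walk = uv , walk
  Walk-join (u ∷ w ∷ xs) v ys (uw , walk₁) walk = uw , Walk-join (w ∷ xs) v ys walk₁ walk

  IsPath-++⁻ˡ : ∀ xs ys → IsPath G (xs ++ ys) → 1 ≤ length xs → IsPath G xs
  IsPath-++⁻ˡ xs ys (_ , uniq , walk) ne = ne , Unique-++⁻ˡ xs ys uniq , Walk-++⁻ˡ xs ys walk

  IsPath-++⁻ʳ : ∀ xs ys → IsPath G (xs ++ ys) → 1 ≤ length ys → IsPath G ys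
  IsPath-++⁻ʳ xs ys (_ , uniq , walk) ne = ne , Unique-++⁻ʳ xs ys uniq , Walk-++⁻ʳ xs ys walk

  module _ {y : Fin n} (A : List (Fin n)) (u w : Fin n) (B : List (Fin n)) where

    open Permutation (setoid (Fin n)) using (_↭_; ↭-sym)
    open PermutationProperties (setoid (Fin n)) using (++-comm; ∈-resp-↭; Unique-resp-↭)

    rotation-length : length (A ++ u ∷ w ∷ B) ≡ suc (length (B ++ y ∷ A))
    rotation-length = begin
      length (A ++ u ∷ w ∷ B)         ≡⟨ length-++ A ⟩
      length A + suc (suc (length B)) ≡⟨ +-suc (length A) (suc (length B)) ⟩
      suc (length A + suc (length B)) ≡⟨ cong suc (+-comm (length A) (suc (length B))) ⟩
      suc (suc (length B + length A)) ≡⟨ cong suc (sym (+-suc (length B) (length A))) ⟩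
      suc (length B + suc (length A)) ≡⟨ cong suc (sym (length-++ B)) ⟩
      suc (length (B ++ y ∷ A))       ∎
      where open ≡-Reasoning

    rotation-nbrsIn : ∀ {x} → Adj G x y → Adj G x u → adj G x w ≡ false →
                      nbrsIn G x (B ++ y ∷ A) ≡ nbrsIn G x (A ++ u ∷ w ∷ B)
    rotation-nbrsIn {x} xy xu xw = begin
      nbrsIn G x (B ++ y ∷ A)               ≡⟨ nbrsIn-++ x B (y ∷ A) ⟩
      nbrsIn G x B + nbrsIn G x (y ∷ A)     ≡⟨ cong (nbrsIn G x B +_) (nbrsIn-∷-adj A xy) ⟩
      nbrsIn G x B + suc (nbrsIn G x A)     ≡⟨ +-suc (nbrsIn G x B) _ ⟩
      suc (nbrsIn G x B + nbrsIn G x A)     ≡⟨ cong suc (+-comm (nbrsIn G x B) _) ⟩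
      suc (nbrsIn G x A + nbrsIn G x B)     ≡⟨ sym (+-suc (nbrsIn G x A) _) ⟩
      nbrsIn G x A + suc (nbrsIn G x B)     ≡⟨ cong (nbrsIn G x A +_) (sym uwB) ⟩
      nbrsIn G x A + nbrsIn G x (u ∷ w ∷ B) ≡⟨ sym (nbrsIn-++ x A (u ∷ w ∷ B)) ⟩
      nbrsIn G x (A ++ u ∷ w ∷ B)           ∎
      where
      open ≡-Reasoning
      uwB : nbrsIn G x (u ∷ w ∷ B) ≡ suc (nbrsIn G x B)
      uwB = trans (nbrsIn-∷-adj (w ∷ B) xu) (cong suc (nbrsIn-∷-nonadj B xw))

    private
      rotation-↭ : y ∷ A ++ u ∷ w ∷ B ↭ u ∷ w ∷ B ++ y ∷ A
      rotation-↭ = ++-comm (y ∷ A) (u ∷ w ∷ B)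

    rotation-∉ : ∀ {x} → x ∉ y ∷ A ++ u ∷ w ∷ B → x ∉ B ++ y ∷ A
    rotation-∉ x∉ = x∉ ∘ ∈-resp-↭ (↭-sym rotation-↭) ∘ there ∘ there

    rotation-isPath : IsPath G (A ++ u ∷ w ∷ B) → y ∉ A ++ u ∷ w ∷ B →
                      Walk G (y ∷ A ++ u ∷ w ∷ B) → Walk G ((A ++ u ∷ w ∷ B) ++ [ y ]) →
                      IsPath G (B ++ y ∷ A)
    rotation-isPath (_ , uniq , _) y∉ yP Py = nonempty , uniq-rotation , Walk-join B y A walk-By walk-yA
      where
      nonempty : 1 ≤ length (B ++ y ∷ A)
      nonempty = subst (1 ≤_) (sym (length-++ B)) (≤-trans (s≤s z≤n) (m≤n+m _ (length B)))
      uniq-rotation : Unique (B ++ y ∷ A)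
      uniq-rotation with Unique-resp-↭ rotation-↭ (¬Any⇒All¬ (A ++ u ∷ w ∷ B) y∉ ∷ uniq)
      ... | _ ∷ _ ∷ uniq′ = uniq′
      walk-yA : Walk G (y ∷ A)
      walk-yA = Walk-++⁻ˡ (y ∷ A) (u ∷ w ∷ B) yP
      walk-By : Walk G (B ++ [ y ])
      walk-By = Walk-++⁻ʳ (A ++ u ∷ w ∷ []) (B ++ [ y ])
        (subst (Walk G) (trans (++-assoc A (u ∷ w ∷ B) [ y ]) (sym (++-assoc A (u ∷ w ∷ []) (B ++ [ y ])))) Py)

  NoShorterSchema : ℕ → List (Fin n) → Set
  NoShorterSchema k P = ∀ L z → IsPath G L → z ∉ L → nbrsIn G z L ≡ suc k → length P ≤ length L

  module _ {k : ℕ} where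

    schema-prefix⇒[] : ∀ {z} xs ys → NoShorterSchema k (xs ++ ys) → IsPath G (xs ++ ys) →
                       z ∉ xs ++ ys → nbrsIn G z xs ≡ suc k → ys ≡ []
    schema-prefix⇒[] xs ys shortest path z∉ count = ++-length-≤ˡ⇒[] xs ys
      (shortest xs _ (IsPath-++⁻ˡ xs ys path (nbrsIn-suc⇒nonempty xs count)) (z∉ ∘ ∈-++⁺ˡ) count)

    schema-suffix⇒[] : ∀ {z} xs ys → NoShorterSchema k (xs ++ ys) → IsPath G (xs ++ ys) →
                       z ∉ xs ++ ys → nbrsIn G z ys ≡ suc k → xs ≡ []
    schema-suffix⇒[] xs ys shortest path z∉ count = ++-length-≤ʳ⇒[] xs ys
      (shortest ys _ (IsPath-++⁻ʳ xs ys path (nbrsIn-suc⇒nonempty ys count)) (z∉ ∘ ∈-++⁺ʳ xs) count)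

    nbrsIn-≤-schema : ∀ {z} P → NoShorterSchema k P → IsPath G P → z ∉ P → nbrsIn G z P ≤ suc k
    nbrsIn-≤-schema {z} P shortest path z∉ = s≤s⁻¹ (≰⇒> too-many)
      where
      too-many : ¬ (suc (suc k) ≤ nbrsIn G z P)
      too-many many with split-at-nbrs z P (suc k) (≤-trans (n≤1+n _) many)
      ... | xs , ys , refl , count with schema-prefix⇒[] xs ys shortest path z∉ count
      ... | refl = 1+n≰n (begin
        suc (suc k)           ≤⟨ many ⟩
        nbrsIn G z (xs ++ []) ≡⟨ nbrsIn-++ z xs [] ⟩
        nbrsIn G z xs + 0     ≡⟨ +-identityʳ _ ⟩
        nbrsIn G z xs         ≡⟨ count ⟩
        suc k                 ∎)
        where open ≤-Reasoning

    schema-walk-∷ : ∀ {z} P → NoShorterSchema k P → IsPath G P → z ∉ P →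
                    nbrsIn G z P ≡ suc k → Walk G (z ∷ P)
    schema-walk-∷ {z} (q ∷ T) shortest path@(_ , _ , walk) z∉ count with adj G z q in zq
    ... | true  = refl , walk
    -- in this branch the type of count has already reduced to nbrsIn G z T ≡ suc k
    ... | false = contradiction (schema-suffix⇒[] [ q ] T shortest path z∉ count) λ ()

    schema-walk-∷ʳ : ∀ {z} P → NoShorterSchema k P → IsPath G P → z ∉ P →
                     nbrsIn G z P ≡ suc k → Walk G (P ++ [ z ])
    schema-walk-∷ʳ {z} P shortest path z∉ count with initLast P
    schema-walk-∷ʳ {z} .(I ++ [ q ]) shortest path@(_ , _ , walk) z∉ count | I ∷ʳ′ q
      with adj G z q in zq
    ... | true  = subst (Walk G) (sym (++-assoc I [ q ] [ z ])) (Walk-join I q [ z ] walk (Adj-sym zq , tt))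
    ... | false = contradiction (schema-prefix⇒[] I [ q ] shortest path z∉ count-I) λ ()
      where
      count-I : nbrsIn G z I ≡ suc k
      count-I = begin
        nbrsIn G z I                    ≡⟨ sym (+-identityʳ _) ⟩
        nbrsIn G z I + 0                ≡⟨ cong (nbrsIn G z I +_) (sym (nbrsIn-∷-nonadj [] zq)) ⟩
        nbrsIn G z I + nbrsIn G z [ q ] ≡⟨ sym (nbrsIn-++ z I [ q ]) ⟩
        nbrsIn G z (I ++ [ q ])         ≡⟨ count ⟩
        suc k                           ∎
        where open ≡-Reasoning

    descent-shortens-schema : ∀ {x y} P → NoShorterSchema k P → IsPath G P → x ∉ P → y ∉ x ∷ P →
                              Adj G x y → nbrsIn G x P ≡ suc k → Walk G (y ∷ P) → Walk G (P ++ [ y ]) →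
                              Descent (adj G x) P → ⊥
    -- y closes P into a cycle, so cutting the edge uw and inserting y gives the path B y A
    descent-shortens-schema {x} {y} P shortest path x∉ y∉ xy count yP Py
      record { before = A ; after = B ; high = u ; low = w ; split = refl ; high-true = xu ; low-false = xw } =
      1+n≰n (subst (_≤ length (B ++ y ∷ A)) (rotation-length A u w B)
        (shortest (B ++ y ∷ A) x
          (rotation-isPath A u w B path (y∉ ∘ there) yP Py)
          (rotation-∉ A u w B x∉yP)
          (trans (rotation-nbrsIn A u w B xy xu xw) count)))
      where
      x∉yP : x ∉ y ∷ P
      x∉yP (here refl) = y∉ (here refl)
      x∉yP (there x∈) = x∉ x∈

    adjacent-centres⇒All-Adj : ∀ {x y} P → NoShorterSchema k P → IsPath G P → x ∉ P → y ∉ x ∷ P →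
                               Adj G x y → nbrsIn G x P ≡ suc k → nbrsIn G y P ≡ suc k → All (Adj G x) P
    adjacent-centres⇒All-Adj {x} {y} P@(p ∷ T) shortest path x∉ y∉ xy count-x count-y
      with all-or-descent (adj G x) p T (proj₁ (schema-walk-∷ P shortest path x∉ count-x))
    ... | inj₁ all = all
    ... | inj₂ descent = ⊥-elim (descent-shortens-schema P shortest path x∉ y∉ xy count-x
            (schema-walk-∷ P shortest path (y∉ ∘ there) count-y)
            (schema-walk-∷ʳ P shortest path (y∉ ∘ there) count-y)
            descent)

optimal⇒NoShorterSchema : ∀ {n} {G : Graph n} {k} (S : Schema G k) → Optimal S → NoShorterSchema G k (P S)
optimal⇒NoShorterSchema S optimal L z path z∉ count = s≤s⁻¹ (optimal (schema L z path z∉ count))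

lemma2p11 : (k : ℕ) → 2 ≤ k → (n : ℕ) → (G : Graph n) → MinDegAtLeast G (k + 1)
    → (S : Schema G k) → Optimal S
    → (∀ (y : Fin n) → y ∉ VS S → nbrsIn G y (VS S) ≤ k + 2)
      × (∀ (y : Fin n) → y ∉ VS S → nbrsIn G y (VS S) ≡ k + 2
           → Adj G (x S) y × All (λ v → Adj G v (x S)) (P S) × card S ≡ k + 2)
lemma2p11 k _ n G _ S optimal = at-most , saturated
  where
  shortest : NoShorterSchema G k (P S)
  shortest = optimal⇒NoShorterSchema S optimal

  bound : ∀ y → y ∉ VS S → nbrsIn G y (P S) ≤ suc k
  bound y y∉ = nbrsIn-≤-schema G (P S) shortest (isPath S) (y∉ ∘ there)

  at-most : ∀ y → y ∉ VS S → nbrsIn G y (VS S) ≤ k + 2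
  at-most y y∉ = subst (nbrsIn G y (VS S) ≤_) (+-comm 2 k)
    (≤-trans (nbrsIn-∷-≤ G y (x S) (P S)) (s≤s (bound y y∉)))

  saturated : ∀ y → y ∉ VS S → nbrsIn G y (VS S) ≡ k + 2
              → Adj G (x S) y × All (λ v → Adj G v (x S)) (P S) × card S ≡ k + 2
  saturated y y∉ count with nbrsIn-∷-saturated G (P S) (trans count (+-comm k 2)) (bound y y∉)
  ... | yx , count-y = Adj-sym G yx , All.map (Adj-sym G) all , trans |VS| (+-comm 2 k)
    where
    all : All (Adj G (x S)) (P S)
    all = adjacent-centres⇒All-Adj G (P S) shortest (isPath S) (x∉P S) y∉ (Adj-sym G yx) (nbrs S) count-y
    |VS| : card S ≡ 2 + k
    |VS| = cong suc (trans (sym (nbrsIn-all G (P S) all)) (nbrs S))
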